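{- Let $n \geq 6$ and let $G$ be a graph on $n$ vertices with $\delta(G) \geq \lfloor n/2 \rfloor + 1$. Then every vertex of $G$ is contained in a (not necessarily induced) subgraph of $G$ isomorphic to the complete bipartite graph $K_{2,3}$.
   Context: Graphs are finite and simple; $\delta(G)$ is the minimum degree. -}

module Defs where

open import Data.Nat using (ℕ; _≤_; _+_; _/_)
open import Data.Fin using (Fin)
open import Data.Bool using (Bool; true; false; T)
open import Data.List using (List; filter; length)
open import Data.Fin.Base using ()
open import Data.List.Base using ()
open import Data.Sum using (_⊎_; inj₁; inj₂)
open import Data.Product using (Σ; ∃; _×_)
open import Relation.Binary.PropositionalEquality using (_≡_)
open import Relation.Nullary using (¬_)
open import Data.Unit using (⊤)
open import Data.Empty using (⊥)
open import Function.Definitions using (Injective)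
import Data.List as L
import Data.Fin as F
open import Relation.Nullary.Decidable using (does)
open import Data.Bool.Properties using (T?)

record Graph (n : ℕ) : Set where
  field
    adj     : Fin n → Fin n → Bool
    sym     : ∀ u v → adj u v ≡ adj v u
    irrefl  : ∀ v → adj v v ≡ false
open Graph public

neighbours : ∀ {n} → Graph n → Fin n → List (Fin n)
neighbours G v = filter (λ u → T? (adj G v u)) (L.allFin _)

degree : ∀ {n} → Graph n → Fin n → ℕ
degree G v = length (neighbours G v)

MinDegreeAtLeast : ∀ {n} → Graph n → ℕ → Set
MinDegreeAtLeast G d = ∀ v → d ≤ degree G v

K23Vertex : Set
K23Vertex = Fin 2 ⊎ Fin 3

K23Adj : K23Vertex → K23Vertex → Set
K23Adj (inj₁ _) (inj₂ _) = ⊤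
K23Adj (inj₂ _) (inj₁ _) = ⊤
K23Adj (inj₁ _) (inj₁ _) = ⊥
K23Adj (inj₂ _) (inj₂ _) = ⊥

record K23Copy {n : ℕ} (G : Graph n) : Set where
  field
    emb      : K23Vertex → Fin n
    injective : Injective _≡_ _≡_ emb
    edges    : ∀ x y → K23Adj x y → T (adj G (emb x) (emb y))
open K23Copy public

InK23 : ∀ {n} → Graph n → Fin n → Set
InK23 G v = Σ (K23Copy G) λ c → ∃ λ x → emb c x ≡ v

-- If some a ≠ v is not adjacent to v, the neighbourhoods of v and a both avoid {v, a},
-- so by inclusion–exclusion they share at least 2(⌊n/2⌋ + 1) − (n − 2) ≥ 3 vertices.
-- Otherwise v is adjacent to every other vertex, and any neighbour a of v shares all of its
-- neighbours except v with v: at least ⌊n/2⌋ ≥ 3 of them. Either way v, a and three common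
-- neighbours span a K_{2,3}.
module Submission where

open import Defs
open import Data.Nat using (ℕ; _≤_; _+_; _/_)
open import Data.Fin using (Fin)

open import Data.Nat.Base using (zero; suc; _*_; _%_; _<_; NonZero; s≤s; z≤n)
open import Data.Nat.Properties hiding (_≟_)
open import Algebra.Properties.CommutativeSemigroup +-commutativeSemigroup using (x∙yz≈y∙xz)
open import Data.Nat.DivMod using (m≡m%n+[m/n]*n; m%n<n; /-monoˡ-≤)
open import Data.Fin.Subset
  using (Subset; inside; outside; _∈_; _∉_; _⊆_; _∩_; _∪_; _─_; _-_; ⊤; ⁅_⁆; ∣_∣; Nonempty; Empty)
open import Data.Fin.Subset.Properties
  using ( _∈?_; nonempty?; Empty-unique; ∣⊥∣≡0; ∣⊤∣≡n; ∈⊤; p⊆q⇒∣p∣≤∣q∣; x∈p⇒∣p-x∣<∣p∣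
        ; x∈⁅x⁆; p─q⊆p; x∈p∧x∉q⇒x∈p─q; x∈p∧x≢y⇒x∈p-y; x∈p∩q⁺; x∈p∩q⁻; x∈p∪q⁺; x∈p∪q⁻; ∣⁅x⁆∣≡1 )
import Data.Fin.Base as F
open import Data.Fin.Properties using (_≟_)
open import Data.Bool.Base using (Bool; true; false; T)
open import Data.Bool.Properties using (T?; T-≡)
open import Data.List.Base using (filter; length)
import Data.List.Base as L
import Data.Vec.Base as V
open import Data.Vec.Properties using (lookup∘tabulate; lookup⇒[]=; []=⇒lookup)
open import Data.Sum.Base using (inj₁; inj₂)
open import Data.Product.Base using (Σ-syntax; _×_; _,_; proj₁; proj₂)
open import Data.Empty using (⊥-elim)
open import Function.Base using (id)
open import Function.Bundles using (Equivalence)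
open import Function.Definitions using (Injective)
open import Relation.Nullary using (yes; no; contradiction)
open import Relation.Binary.PropositionalEquality
  using (_≡_; _≢_; refl; cong; cong₂; subst; trans; ≢-sym; module ≡-Reasoning)
  renaming (sym to ≡-sym)

private variable
  n : ℕ

m<[m/n+1]*n : ∀ m n .{{_ : NonZero n}} → m < (m / n + 1) * n
m<[m/n+1]*n m n = begin-strict
  m                   ≡⟨ m≡m%n+[m/n]*n m n ⟩
  m % n + (m / n) * n <⟨ +-monoˡ-< ((m / n) * n) (m%n<n m n) ⟩
  n + (m / n) * n     ≡⟨ +-comm n ((m / n) * n) ⟩
  (m / n) * n + n     ≡⟨ cong ((m / n) * n +_) (*-identityˡ n) ⟨
  (m / n) * n + 1 * n ≡⟨ *-distribʳ-+ n (m / n) 1 ⟨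
  (m / n + 1) * n     ∎
  where open ≤-Reasoning

m<[m/2+1]+[m/2+1] : ∀ m → m < (m / 2 + 1) + (m / 2 + 1)
m<[m/2+1]+[m/2+1] m = subst (m <_) [m/2+1]*2≡[m/2+1]+[m/2+1] (m<[m/n+1]*n m 2)
  where
  [m/2+1]*2≡[m/2+1]+[m/2+1] : (m / 2 + 1) * 2 ≡ (m / 2 + 1) + (m / 2 + 1)
  [m/2+1]*2≡[m/2+1]+[m/2+1] =
    trans (*-comm (m / 2 + 1) 2) (cong ((m / 2 + 1) +_) (+-identityʳ (m / 2 + 1)))

+-suc-cong : ∀ {a b c d} → a + b ≡ c + d → a + suc b ≡ c + suc d
+-suc-cong {a} {b} {c} {d} eq = begin
  a + suc b   ≡⟨ +-suc a b ⟩
  suc (a + b) ≡⟨ cong suc eq ⟩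
  suc (c + d) ≡⟨ +-suc c d ⟨
  c + suc d   ∎
  where open ≡-Reasoning

∣p∩q∣+∣p∪q∣≡∣p∣+∣q∣ : ∀ (p q : Subset n) → ∣ p ∩ q ∣ + ∣ p ∪ q ∣ ≡ ∣ p ∣ + ∣ q ∣
∣p∩q∣+∣p∪q∣≡∣p∣+∣q∣ V.[] V.[] = refl
∣p∩q∣+∣p∪q∣≡∣p∣+∣q∣ (outside V.∷ p) (outside V.∷ q) = ∣p∩q∣+∣p∪q∣≡∣p∣+∣q∣ p q
∣p∩q∣+∣p∪q∣≡∣p∣+∣q∣ (inside V.∷ p) (outside V.∷ q) =
  trans (+-suc ∣ p ∩ q ∣ ∣ p ∪ q ∣) (cong suc (∣p∩q∣+∣p∪q∣≡∣p∣+∣q∣ p q))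
∣p∩q∣+∣p∪q∣≡∣p∣+∣q∣ (outside V.∷ p) (inside V.∷ q) = +-suc-cong (∣p∩q∣+∣p∪q∣≡∣p∣+∣q∣ p q)
∣p∩q∣+∣p∪q∣≡∣p∣+∣q∣ (inside V.∷ p) (inside V.∷ q) = cong suc (+-suc-cong (∣p∩q∣+∣p∪q∣≡∣p∣+∣q∣ p q))

x∈p─q⇒x∉q : ∀ {x} {p q : Subset n} → x ∈ p ─ q → x ∉ q
x∈p─q⇒x∉q {p = _ V.∷ _} {q = outside V.∷ _} (V.there x∈p─q) (V.there x∈q) = x∈p─q⇒x∉q x∈p─q x∈q
x∈p─q⇒x∉q {p = _ V.∷ _} {q = inside V.∷ _}  (V.there x∈p─q) (V.there x∈q) = x∈p─q⇒x∉q x∈p─q x∈q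

x∈p-y⇒x≢y : ∀ {x y} {p : Subset n} → x ∈ p - y → x ≢ y
x∈p-y⇒x≢y x∈p-y refl = x∈p─q⇒x∉q x∈p-y (x∈⁅x⁆ _)

∣p∪q∣≤∣p∣+∣q∣ : ∀ (p q : Subset n) → ∣ p ∪ q ∣ ≤ ∣ p ∣ + ∣ q ∣
∣p∪q∣≤∣p∣+∣q∣ p q = subst (∣ p ∪ q ∣ ≤_) (∣p∩q∣+∣p∪q∣≡∣p∣+∣q∣ p q) (m≤n+m ∣ p ∪ q ∣ ∣ p ∩ q ∣)

p⊆[p-x]∪⁅x⁆ : ∀ (p : Subset n) x → p ⊆ (p - x) ∪ ⁅ x ⁆
p⊆[p-x]∪⁅x⁆ p x {y} y∈p with y ≟ x
... | yes refl = x∈p∪q⁺ (inj₂ (x∈⁅x⁆ x))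
... | no y≢x   = x∈p∪q⁺ (inj₁ (x∈p∧x≢y⇒x∈p-y y∈p y≢x))

∣p∣≤1+∣p-x∣ : ∀ (p : Subset n) x → ∣ p ∣ ≤ suc ∣ p - x ∣
∣p∣≤1+∣p-x∣ p x = begin
  ∣ p ∣                   ≤⟨ p⊆q⇒∣p∣≤∣q∣ (p⊆[p-x]∪⁅x⁆ p x) ⟩
  ∣ (p - x) ∪ ⁅ x ⁆ ∣     ≤⟨ ∣p∪q∣≤∣p∣+∣q∣ (p - x) ⁅ x ⁆ ⟩
  ∣ p - x ∣ + ∣ ⁅ x ⁆ ∣   ≡⟨ cong (∣ p - x ∣ +_) (∣⁅x⁆∣≡1 x) ⟩
  ∣ p - x ∣ + 1           ≡⟨ +-comm ∣ p - x ∣ 1 ⟩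
  suc ∣ p - x ∣           ∎
  where open ≤-Reasoning

0<∣p∣⇒Nonempty : ∀ (p : Subset n) → 0 < ∣ p ∣ → Nonempty p
0<∣p∣⇒Nonempty {n} p 0<∣p∣ with nonempty? p
... | yes ne   = ne
... | no empty = contradiction (trans (cong ∣_∣ (Empty-unique empty)) (∣⊥∣≡0 n)) (>⇒≢ 0<∣p∣)

Empty[p─q]⇒p⊆q : ∀ (p q : Subset n) → Empty (p ─ q) → p ⊆ q
Empty[p─q]⇒p⊆q p q empty {x} x∈p with x ∈? q
... | yes x∈q = x∈q
... | no x∉q  = contradiction (x , x∈p∧x∉q⇒x∈p─q x∈p x∉q) empty

distinctMembers : ∀ k (p : Subset n) → k ≤ ∣ p ∣ →
  Σ[ f ∈ (Fin k → Fin n) ] Injective _≡_ _≡_ f × (∀ i → f i ∈ p)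
distinctMembers zero    p _     = (λ ()) , (λ { {()} }) , λ ()
distinctMembers {n} (suc k) p k<∣p∣ with 0<∣p∣⇒Nonempty p (≤-trans (s≤s z≤n) k<∣p∣)
... | x , x∈p with distinctMembers k (p - x) (≤-pred (≤-trans k<∣p∣ (∣p∣≤1+∣p-x∣ p x)))
... | f , f-injective , f∈p-x = g , g-injective , g∈p
  where
  g : Fin (suc k) → Fin n
  g F.zero    = x
  g (F.suc i) = f i
  g∈p : ∀ i → g i ∈ p
  g∈p F.zero    = x∈p
  g∈p (F.suc i) = p─q⊆p p ⁅ x ⁆ (f∈p-x i)
  g-injective : Injective _≡_ _≡_ g
  g-injective {F.zero}  {F.zero}  _   = refl
  g-injective {F.zero}  {F.suc j} x≡fj = ⊥-elim (x∈p-y⇒x≢y (f∈p-x j) (≡-sym x≡fj))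
  g-injective {F.suc i} {F.zero}  fi≡x = ⊥-elim (x∈p-y⇒x≢y (f∈p-x i) fi≡x)
  g-injective {F.suc i} {F.suc j} fi≡fj = cong F.suc (f-injective fi≡fj)

length-filter-tabulate : ∀ {A : Set} (f : A → Bool) (g : Fin n → A) →
  length (filter (λ u → T? (f u)) (L.tabulate g)) ≡ ∣ V.tabulate (λ i → f (g i)) ∣
length-filter-tabulate {zero}  f g = refl
length-filter-tabulate {suc n} f g with f (g F.zero)
... | true  = cong suc (length-filter-tabulate f (λ i → g (F.suc i)))
... | false = length-filter-tabulate f (λ i → g (F.suc i))

module _ {n} (G : Graph n) where

  adj-sym : ∀ {u v} → T (adj G u v) → T (adj G v u)
  adj-sym {u} {v} = subst T (Graph.sym G u v)

  adj⇒≢ : ∀ {u v} → T (adj G u v) → u ≢ v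
  adj⇒≢ {u} uu refl = subst T (irrefl G u) uu

  neighbourhood : Fin n → Subset n
  neighbourhood v = V.tabulate (adj G v)

  codegree : Fin n → Fin n → ℕ
  codegree v a = ∣ neighbourhood v ∩ neighbourhood a ∣

  ∈-neighbourhood⁺ : ∀ {v x} → T (adj G v x) → x ∈ neighbourhood v
  ∈-neighbourhood⁺ {v} {x} vx =
    lookup⇒[]= x (neighbourhood v) (trans (lookup∘tabulate (adj G v) x) (Equivalence.to T-≡ vx))

  ∈-neighbourhood⁻ : ∀ {v x} → x ∈ neighbourhood v → T (adj G v x)
  ∈-neighbourhood⁻ {v} {x} x∈N =
    Equivalence.from T-≡ (trans (≡-sym (lookup∘tabulate (adj G v) x)) ([]=⇒lookup x∈N))

  degree≡∣neighbourhood∣ : ∀ v → degree G v ≡ ∣ neighbourhood v ∣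
  degree≡∣neighbourhood∣ v = length-filter-tabulate (adj G v) id

  biclique⇒K23Copy : (s : Fin 2 → Fin n) (t : Fin 3 → Fin n) →
    Injective _≡_ _≡_ s → Injective _≡_ _≡_ t → (∀ i j → T (adj G (s i) (t j))) → K23Copy G
  biclique⇒K23Copy s t s-injective t-injective st = record
    { emb = emb′ ; injective = emb′-injective ; edges = emb′-edges }
    where
    emb′ : K23Vertex → Fin n
    emb′ (inj₁ i) = s i
    emb′ (inj₂ j) = t j
    emb′-injective : Injective _≡_ _≡_ emb′
    emb′-injective {inj₁ i} {inj₁ i′} si≡si′ = cong inj₁ (s-injective si≡si′)
    emb′-injective {inj₂ j} {inj₂ j′} tj≡tj′ = cong inj₂ (t-injective tj≡tj′)
    emb′-injective {inj₁ i} {inj₂ j}  si≡tj  = ⊥-elim (adj⇒≢ (st i j) si≡tj)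
    emb′-injective {inj₂ j} {inj₁ i}  tj≡si  = ⊥-elim (adj⇒≢ (st i j) (≡-sym tj≡si))
    emb′-edges : ∀ x y → K23Adj x y → T (adj G (emb′ x) (emb′ y))
    emb′-edges (inj₁ i) (inj₂ j) _ = st i j
    emb′-edges (inj₂ j) (inj₁ i) _ = adj-sym (st i j)

  3≤codegree⇒InK23 : ∀ {v a} → a ≢ v → 3 ≤ codegree v a → InK23 G v
  3≤codegree⇒InK23 {v} {a} a≢v 3≤codegree =
    biclique⇒K23Copy s t s-injective t-injective st , inj₁ F.zero , refl
    where
    commonNeighbours : Σ[ f ∈ (Fin 3 → Fin n) ]
      Injective _≡_ _≡_ f × (∀ j → f j ∈ neighbourhood v ∩ neighbourhood a)
    commonNeighbours = distinctMembers 3 (neighbourhood v ∩ neighbourhood a) 3≤codegree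
    t : Fin 3 → Fin n
    t = proj₁ commonNeighbours
    t-injective : Injective _≡_ _≡_ t
    t-injective = proj₁ (proj₂ commonNeighbours)
    t∈N∩N : ∀ j → t j ∈ neighbourhood v ∩ neighbourhood a
    t∈N∩N = proj₂ (proj₂ commonNeighbours)
    s : Fin 2 → Fin n
    s F.zero    = v
    s (F.suc _) = a
    s-injective : Injective _≡_ _≡_ s
    s-injective {F.zero}          {F.zero}          _   = refl
    s-injective {F.zero}          {F.suc F.zero}    v≡a = ⊥-elim (a≢v (≡-sym v≡a))
    s-injective {F.suc F.zero}    {F.zero}          a≡v = ⊥-elim (a≢v a≡v)
    s-injective {F.suc F.zero}    {F.suc F.zero}    _   = refl
    st : ∀ i j → T (adj G (s i) (t j))
    st F.zero    j = ∈-neighbourhood⁻ (proj₁ (x∈p∩q⁻ (neighbourhood v) (neighbourhood a) (t∈N∩N j)))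
    st (F.suc _) j = ∈-neighbourhood⁻ (proj₂ (x∈p∩q⁻ (neighbourhood v) (neighbourhood a) (t∈N∩N j)))

  nonadjacent⇒degree-sum≤codegree : ∀ {v a} → a ≢ v → a ∉ neighbourhood v →
    2 + (degree G v + degree G a) ≤ codegree v a + n
  nonadjacent⇒degree-sum≤codegree {v} {a} a≢v a∉Nv = begin
    2 + (degree G v + degree G a) ≡⟨ cong (2 +_) (cong₂ _+_ (degree≡∣neighbourhood∣ v) (degree≡∣neighbourhood∣ a)) ⟩
    2 + (∣ Nv ∣ + ∣ Na ∣)           ≡⟨ cong (2 +_) (∣p∩q∣+∣p∪q∣≡∣p∣+∣q∣ Nv Na) ⟨
    2 + (codegree v a + ∣ Nv ∪ Na ∣) ≡⟨ x∙yz≈y∙xz 2 (codegree v a) ∣ Nv ∪ Na ∣ ⟩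
    codegree v a + (2 + ∣ Nv ∪ Na ∣) ≤⟨ +-monoʳ-≤ (codegree v a) (+-monoʳ-≤ 2 (p⊆q⇒∣p∣≤∣q∣ Nv∪Na⊆⊤-v-a)) ⟩
    codegree v a + (2 + ∣ ⊤ - v - a ∣) ≤⟨ +-monoʳ-≤ (codegree v a) 2+∣⊤-v-a∣≤n ⟩
    codegree v a + n                 ∎
    where
    open ≤-Reasoning
    Nv Na : Subset n
    Nv = neighbourhood v
    Na = neighbourhood a
    a∈⊤-v : a ∈ ⊤ - v
    a∈⊤-v = x∈p∧x≢y⇒x∈p-y ∈⊤ a≢v
    2+∣⊤-v-a∣≤n : 2 + ∣ ⊤ - v - a ∣ ≤ n
    2+∣⊤-v-a∣≤n = subst (2 + ∣ ⊤ - v - a ∣ ≤_) (∣⊤∣≡n n)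
      (≤-trans (s≤s (x∈p⇒∣p-x∣<∣p∣ a∈⊤-v)) (x∈p⇒∣p-x∣<∣p∣ (∈⊤ {x = v})))
    Nv∪Na⊆⊤-v-a : Nv ∪ Na ⊆ ⊤ - v - a
    Nv∪Na⊆⊤-v-a {y} y∈Nv∪Na with x∈p∪q⁻ Nv Na y∈Nv∪Na
    ... | inj₁ y∈Nv = x∈p∧x≢y⇒x∈p-y (x∈p∧x≢y⇒x∈p-y ∈⊤ y≢v) y≢a
      where
      y≢v : y ≢ v
      y≢v = ≢-sym (adj⇒≢ (∈-neighbourhood⁻ y∈Nv))
      y≢a : y ≢ a
      y≢a refl = a∉Nv y∈Nv
    ... | inj₂ y∈Na = x∈p∧x≢y⇒x∈p-y (x∈p∧x≢y⇒x∈p-y ∈⊤ y≢v) y≢a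
      where
      y≢v : y ≢ v
      y≢v refl = a∉Nv (∈-neighbourhood⁺ (adj-sym (∈-neighbourhood⁻ y∈Na)))
      y≢a : y ≢ a
      y≢a = ≢-sym (adj⇒≢ (∈-neighbourhood⁻ y∈Na))

  dominating⇒degree≤1+codegree : ∀ {v} a → ⊤ - v ⊆ neighbourhood v → degree G a ≤ suc (codegree v a)
  dominating⇒degree≤1+codegree {v} a ⊤-v⊆Nv = begin
    degree G a      ≡⟨ degree≡∣neighbourhood∣ a ⟩
    ∣ Na ∣          ≤⟨ ∣p∣≤1+∣p-x∣ Na v ⟩
    suc ∣ Na - v ∣  ≤⟨ s≤s (p⊆q⇒∣p∣≤∣q∣ Na-v⊆Nv∩Na) ⟩
    suc (codegree v a) ∎
    where
    open ≤-Reasoning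
    Na : Subset n
    Na = neighbourhood a
    Na-v⊆Nv∩Na : Na - v ⊆ neighbourhood v ∩ Na
    Na-v⊆Nv∩Na y∈Na-v = x∈p∩q⁺
      (⊤-v⊆Nv (x∈p∧x≢y⇒x∈p-y ∈⊤ (x∈p-y⇒x≢y y∈Na-v)) , p─q⊆p Na ⁅ v ⁆ y∈Na-v)

  nonadjacent⇒3≤codegree : MinDegreeAtLeast G (n / 2 + 1) →
    ∀ {v a} → a ≢ v → a ∉ neighbourhood v → 3 ≤ codegree v a
  nonadjacent⇒3≤codegree δ {v} {a} a≢v a∉Nv = +-cancelʳ-≤ n 3 (codegree v a) (begin
    2 + suc n                     ≤⟨ +-monoʳ-≤ 2 (≤-trans (m<[m/2+1]+[m/2+1] n) (+-mono-≤ (δ v) (δ a))) ⟩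
    2 + (degree G v + degree G a) ≤⟨ nonadjacent⇒degree-sum≤codegree a≢v a∉Nv ⟩
    codegree v a + n              ∎)
    where open ≤-Reasoning

  dominating⇒3≤codegree : 6 ≤ n → MinDegreeAtLeast G (n / 2 + 1) →
    ∀ {v} a → ⊤ - v ⊆ neighbourhood v → 3 ≤ codegree v a
  dominating⇒3≤codegree 6≤n δ {v} a ⊤-v⊆Nv = ≤-pred (begin
    4                  ≤⟨ +-monoˡ-≤ 1 (/-monoˡ-≤ 2 6≤n) ⟩
    n / 2 + 1          ≤⟨ δ a ⟩
    degree G a         ≤⟨ dominating⇒degree≤1+codegree a ⊤-v⊆Nv ⟩
    suc (codegree v a) ∎)
    where open ≤-Reasoning

lemma3p3 : (n : ℕ) → 6 ≤ n → (G : Graph n) →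
    MinDegreeAtLeast G (n / 2 + 1) → (v : Fin n) → InK23 G v
lemma3p3 n 6≤n G δ v with nonempty? ((⊤ - v) ─ neighbourhood G v)
... | yes (a , a∈[⊤-v]─Nv) = 3≤codegree⇒InK23 G a≢v (nonadjacent⇒3≤codegree G δ a≢v a∉Nv)
  where
  a≢v : a ≢ v
  a≢v = x∈p-y⇒x≢y (p─q⊆p (⊤ - v) (neighbourhood G v) a∈[⊤-v]─Nv)
  a∉Nv : a ∉ neighbourhood G v
  a∉Nv = x∈p─q⇒x∉q a∈[⊤-v]─Nv
... | no empty = 3≤codegree⇒InK23 G a≢v (dominating⇒3≤codegree G 6≤n δ a ⊤-v⊆Nv)
  where
  ⊤-v⊆Nv : ⊤ - v ⊆ neighbourhood G v
  ⊤-v⊆Nv = Empty[p─q]⇒p⊆q (⊤ - v) (neighbourhood G v) empty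
  neighbour : Nonempty (neighbourhood G v)
  neighbour = 0<∣p∣⇒Nonempty (neighbourhood G v)
    (subst (0 <_) (degree≡∣neighbourhood∣ G v) (≤-trans (m≤n+m 1 (n / 2)) (δ v)))
  a : Fin n
  a = proj₁ neighbour
  a≢v : a ≢ v
  a≢v = ≢-sym (adj⇒≢ G (∈-neighbourhood⁻ G (proj₂ neighbour)))
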